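{- For all integers $m\geq 1$ and $n\geq 1$, the graph $m\Gamma(\mathbb{Z}_6)+n\Gamma(\mathbb{Z}_4)$ (the join of $m\Gamma(\mathbb{Z}_6)$ and $n\Gamma(\mathbb{Z}_4)$) does not admit a distance antimagic labeling.
   Context: For an integer $n \geq 2$, the zero-divisor graph $\Gamma(\mathbb{Z}_n)$ is the simple graph whose vertex set is the set of nonzero zero-divisors of the ring $\mathbb{Z}_n$, two distinct vertices $u,v$ being adjacent iff $uv \equiv 0 \pmod n$. For a graph $H$ and positive integer $k$, $kH$ denotes the disjoint union of $k$ copies of $H$. For graphs $G,H$, the join $G+H$ is the graph obtained from the disjoint union of $G$ and $H$ by adding every edge between a vertex of $G$ and a vertex of $H$. A distance antimagic labeling (DAML) of a graph $G$ with $N$ vertices is a bijection $f:V(G)\to\{1,\dots,N\}$ such that the weights $w(v)=\sum_{u\in N(v)} f(u)$, where $N(v)$ is the open neighbourhood of $v$, are pairwise distinct over all vertices $v$. A graph admits DAML if such a labeling exists. -}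

module Defs where

open import Data.Nat using (ℕ; zero; suc; _+_; _*_; _%_; _≡ᵇ_)
open import Data.Bool using (Bool; true; false; _∧_; not; if_then_else_)
open import Data.Fin as Fin using (Fin; toℕ; splitAt; remQuot; _≟_)
open import Data.Sum using (_⊎_; inj₁; inj₂)
open import Data.Product using (Σ; _×_; _,_; proj₁; proj₂)
open import Data.List using (List; []; _∷_; length; filter; upTo; map; lookup)
open import Data.Bool.ListAction using (any)
open import Data.Nat.ListAction using (sum)
import Data.List as List
open import Relation.Nullary.Decidable using (⌊_⌋)
open import Function.Definitions using (Bijective; Injective)
open import Relation.Binary.PropositionalEquality using (_≡_)

record Graph : Set where
  field
    V   : ℕ
    adj : Fin V → Fin V → Bool
open Graph public

nonzero : ℕ → List ℕ
nonzero n = map suc (upTo (n Data.Nat.∸ 1))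
  where import Data.Nat

mul0 : (n : ℕ) → ℕ → ℕ → Bool
mul0 zero    x y = (x * y) ≡ᵇ 0
mul0 (suc k) x y = ((x * y) % suc k) ≡ᵇ 0

zeroDivisors : ℕ → List ℕ
zeroDivisors n = filter (λ x → Data.Bool._≟_ (any (mul0 n x) (nonzero n)) true) (nonzero n)
  where import Data.Bool

Γℤ : ℕ → Graph
Γℤ n = record
  { V   = length (zeroDivisors n)
  ; adj = λ i j → not ⌊ i ≟ j ⌋ ∧ mul0 n (lookup (zeroDivisors n) i) (lookup (zeroDivisors n) j)
  }

-- k H : disjoint union of k copies of H; vertex (c , v) ↦ copy c, vertex v
copies : ℕ → Graph → Graph
copies k H = record
  { V   = k * V H
  ; adj = λ a b → let (ca , va) = remQuot {k} (V H) a ; (cb , vb) = remQuot {k} (V H) b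
                  in ⌊ ca ≟ cb ⌋ ∧ adj H va vb
  }

joinG : Graph → Graph → Graph
joinG G H = record
  { V   = V G + V H
  ; adj = λ a b → go (splitAt (V G) a) (splitAt (V G) b)
  }
  where
    go : Fin (V G) ⊎ Fin (V H) → Fin (V G) ⊎ Fin (V H) → Bool
    go (inj₁ x) (inj₁ y) = adj G x y
    go (inj₂ x) (inj₂ y) = adj H x y
    go (inj₁ _) (inj₂ _) = true
    go (inj₂ _) (inj₁ _) = true

-- weight of v under labeling f, where vertex u receives label toℕ (f u) + 1 ∈ {1..N}
weight : (G : Graph) → (Fin (V G) → Fin (V G)) → Fin (V G) → ℕ
weight G f v = sum (List.tabulate (λ u → if adj G v u then suc (toℕ (f u)) else 0))

IsDAML : (G : Graph) → (Fin (V G) → Fin (V G)) → Set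
IsDAML G f = Bijective _≡_ _≡_ f × Injective _≡_ _≡_ (weight G f)

AdmitsDAML : Graph → Set
AdmitsDAML G = Σ (Fin (V G) → Fin (V G)) (IsDAML G)

-- Vertices 2 and 4 of Γ(ℤ₆) are both adjacent to 3 alone, so they have the same
-- open neighbourhood.  Disjoint unions and joins preserve this, and two distinct
-- vertices with equal open neighbourhoods receive equal weights under every labeling.
module Submission where

open import Defs
open import Data.Nat using (ℕ; suc; _*_; _≥_)
open import Data.Nat.ListAction using (sum)
open import Data.Bool using (if_then_else_; _∧_)
open import Data.Fin using (Fin; zero; suc; combine; remQuot; _↑ˡ_; splitAt; _≟_)
open import Data.Fin.Properties using (remQuot-combine; combine-injectiveʳ; splitAt-↑ˡ; ↑ˡ-injective)
open import Data.List.Properties using (tabulate-cong)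
open import Data.Sum using (inj₁; inj₂)
open import Data.Product using (_,_; proj₁; proj₂)
open import Relation.Nullary.Decidable using (⌊_⌋)
open import Function using (_∘_)
open import Relation.Nullary using (¬_)
open import Relation.Binary.PropositionalEquality using (_≡_; _≢_; refl; cong; module ≡-Reasoning)

Twins : (G : Graph) → Fin (V G) → Fin (V G) → Set
Twins G a b = ∀ u → adj G a u ≡ adj G b u

weight-twins : (G : Graph) (f : Fin (V G) → Fin (V G)) {a b : Fin (V G)} →
  Twins G a b → weight G f a ≡ weight G f b
weight-twins G f tw =
  cong sum (tabulate-cong λ u → cong (λ c → if c then _ else 0) (tw u))

twins⇒¬AdmitsDAML : (G : Graph) {a b : Fin (V G)} → a ≢ b → Twins G a b → ¬ AdmitsDAML G
twins⇒¬AdmitsDAML G a≢b tw (f , _ , weight-injective) =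
  a≢b (weight-injective (weight-twins G f tw))

copies-adj-combine : (k : ℕ) (H : Graph) (c : Fin k) (a : Fin (V H)) (u : Fin (k * V H)) →
  let (c′ , v) = remQuot {k} (V H) u in
  adj (copies k H) (combine c a) u ≡ ⌊ c ≟ c′ ⌋ ∧ adj H a v
copies-adj-combine k H c a u =
  cong (λ (c″ , a″) → ⌊ c″ ≟ _ ⌋ ∧ adj H a″ _) (remQuot-combine {k} {V H} c a)

copies-twins : (k : ℕ) (H : Graph) (c : Fin k) (a b : Fin (V H)) →
  Twins H a b → Twins (copies k H) (combine c a) (combine c b)
copies-twins k H c a b tw u = begin
  adj (copies k H) (combine c a) u  ≡⟨ copies-adj-combine k H c a u ⟩
  ⌊ c ≟ c′ ⌋ ∧ adj H a v            ≡⟨ cong (⌊ c ≟ c′ ⌋ ∧_) (tw v) ⟩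
  ⌊ c ≟ c′ ⌋ ∧ adj H b v            ≡⟨ copies-adj-combine k H c b u ⟨
  adj (copies k H) (combine c b) u  ∎
  where
    open ≡-Reasoning
    c′ = proj₁ (remQuot {k} (V H) u)
    v  = proj₂ (remQuot {k} (V H) u)

joinG-twinsˡ : (G H : Graph) (a b : Fin (V G)) →
  Twins G a b → Twins (joinG G H) (a ↑ˡ V H) (b ↑ˡ V H)
joinG-twinsˡ G H a b tw u
  rewrite splitAt-↑ˡ (V G) a (V H) | splitAt-↑ˡ (V G) b (V H)
  with splitAt (V G) u
... | inj₁ x = tw x
... | inj₂ _ = refl

-- Indices 0 and 2 of zeroDivisors 6 = [2, 3, 4] are the residues 2 and 4.
Γℤ6-twins : Twins (Γℤ 6) zero (suc (suc zero))
Γℤ6-twins zero             = refl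
Γℤ6-twins (suc zero)       = refl
Γℤ6-twins (suc (suc zero)) = refl

theorem2p5 : (m n : ℕ) → m ≥ 1 → n ≥ 1 →
    ¬ AdmitsDAML (joinG (copies m (Γℤ 6)) (copies n (Γℤ 4)))
theorem2p5 (suc m) n _ _ =
  twins⇒¬AdmitsDAML (joinG G H) (two≢four ∘ ↑ˡ-injective (V H) two four)
    (joinG-twinsˡ G H two four (copies-twins (suc m) (Γℤ 6) zero 2ᵢ 4ᵢ Γℤ6-twins))
  where
    G = copies (suc m) (Γℤ 6)
    H = copies n (Γℤ 4)
    2ᵢ 4ᵢ : Fin (V (Γℤ 6))
    2ᵢ = zero
    4ᵢ = suc (suc zero)
    two four : Fin (V G)
    two  = combine {suc m} zero 2ᵢ
    four = combine {suc m} zero 4ᵢ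
    two≢four : two ≢ four
    two≢four eq with combine-injectiveʳ {suc m} zero 2ᵢ zero 4ᵢ eq
    ... | ()
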